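{- Let $\Gamma_\Phi$ be the CSTN constructed from a Q3SAT formula $\Phi$, and let $\sigma$ be a viable and dynamic execution strategy for $\Gamma_\Phi$. Let $s$ be any scenario and $i\in\{1,\dots,n\}$, and suppose $[\sigma(s)]_{B_i}-[\sigma(s)]_{A_i}\le n$. Then for some $h\in\{0,1\}$ we have $[\sigma(s)]_{C_i^h}\le[\sigma(s)]_{B_i}+1$.
   Context: CSTN notions: a label over a finite set $\mathcal P$ of propositional variables is a conjunction of literals on distinct variables; the empty label $\lambda$ is always true. A scenario is $s:\mathcal P\to\{0,1\}$; $s\vDash\ell$ means $\ell$ true under $s$. A CSTN is $\Gamma=(\mathcal T,\mathcal P,\mathcal C,\mathcal L,\mathcal{OT},\mathcal O)$ with $\mathcal T$ a finite set of tasks, $\mathcal C$ a finite set of labeled constraints $(Y-X\le\delta,\ell)$, $\mathcal L$ a label on each task, $\mathcal{OT}\subseteq\mathcal T$, $\mathcal O:\mathcal P\to\mathcal{OT}$ a bijection. For a scenario $s$, $\mathcal T_s=\{X:s\vDash\mathcal L(X)\}$ and $\mathcal C_s$ is the set of constraints $Y-X\le\delta$ whose label holds in $s$. An execution strategy $\sigma$ maps each scenario $s$ to $\sigma(s):\mathcal T_s\to\mathbb R$ (write $[\sigma(s)]_X$); it is viable if each $\sigma(s)$ satisfies all constraints of $\mathcal C_s$. $\mathrm{Hist}(t,s,\sigma)$ is the restriction of $s$ to $\{p:[\sigma(s)]_{\mathcal O(p)}<t\}$. $\sigma$ is dynamic if for all $s,s'$ and $X\in\mathcal T_s$, with $t=[\sigma(s)]_X$,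 $\mathrm{Hist}(t,s,\sigma)=\mathrm{Hist}(t,s',\sigma)$ implies $X\in\mathcal T_{s'}$ and $[\sigma(s')]_X=t$. Construction: $\Phi=\exists x_1\forall y_1\cdots\exists x_n\forall y_n\,\varphi$ with $\varphi=\bigwedge_{j=1}^m(l_{j,1}\vee l_{j,2}\vee l_{j,3})$, each literal a positive or negated occurrence of one of $x_1,y_1,\dots,x_n,y_n$. $\Gamma_\Phi$ has tasks $A_i,B_i,C_i^0,C_i^1,D_i,X_i,Y_i$ ($i=1,\dots,n$) and $A_{n+1},B_{n+1}$; propositional variables $x_i,y_i,c_i^0,c_i^1$; all task labels empty; $\mathcal O(x_i)=X_i$, $\mathcal O(y_i)=Y_i$, $\mathcal O(c_i^0)=C_i^0$, $\mathcal O(c_i^1)=C_i^1$; constraints: $(B_1-A_1\le0,\lambda)$; for $i=1,\dots,n$: $(D_i\le B_i+1,\ c_i^0\wedge c_i^1)$, $(D_i\ge A_i+(n+2),\ \neg c_i^0\wedge\neg c_i^1)$, $(X_i\ge A_i+(n+2),\lambda)$, $(Y_i\ge X_i+1,\lambda)$, $(A_{i+1}\ge Y_i+1,\lambda)$, $(B_{i+1}\le C_i^0+(n+4),\ \neg x_i)$, $(B_{i+1}\le C_i^1+(n+4),\ x_i)$; for $j=1,\dots,m$: $(B_{n+1}-A_{n+1}\ge n+1,\ \neg l_{j,1}\wedge\neg l_{j,2}\wedge\neg l_{j,3})$.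
   Formalization: Each $\sigma(s)$ of the execution strategy σ takes values in ℚ rather than ℝ. -}

module Defs where

open import Data.Bool using (Bool; true; false; not)
open import Data.Nat using (ℕ; suc)
open import Data.Fin using (Fin; inject₁; fromℕ)
open import Data.Integer using (+_)
open import Data.Rational using (ℚ; _/_; _≤_; _<_; _+_; _-_; -_)
open import Data.List using (List; []; _∷_; _++_; concatMap; map; allFin)
open import Data.List.Relation.Unary.All using (All)
open import Data.List.Membership.Propositional using (_∈_)
open import Data.Product using (Σ; _×_; _,_)
open import Relation.Binary.PropositionalEquality using (_≡_; refl)

ℕ→ℚ : ℕ → ℚ
ℕ→ℚ k = + k / 1

-- A literal over propositional variables P: (p , b) means "p has value b"
-- (b = true: positive literal p, b = false: negative literal ¬p).
Literal : Set → Set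
Literal P = P × Bool

-- A label is a conjunction of literals; the empty list is the empty label λ.
Label : Set → Set
Label P = List (Literal P)

Scenario : Set → Set
Scenario P = P → Bool

_⊨_ : {P : Set} → Scenario P → Label P → Set
s ⊨ ℓ = All (λ lit → s (Data.Product.proj₁ lit) ≡ Data.Product.proj₂ lit) ℓ

-- labeled constraint (Y - X ≤ δ , ℓ)
record Constraint (T P : Set) : Set where
  constructor cstr
  field
    Y     : T
    X     : T
    δ     : ℚ
    label : Label P

record CSTN : Set₁ where
  field
    Task        : Set
    Prop        : Set
    constraints : List (Constraint Task Prop)
    L           : Task → Label Prop
    O           : Prop → Task
    O-injective : ∀ p q → O p ≡ O q → p ≡ q

module _ (Γ : CSTN) where
  open CSTN Γ

  InScenario : Scenario Prop → Task → Set
  InScenario s X = s ⊨ L X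

  -- An execution strategy assigns to each scenario a schedule; we model
  -- σ(s) as a total map Task → ℚ of which only the values on T_s matter.
  Strategy : Set
  Strategy = Scenario Prop → Task → ℚ

  Viable : Strategy → Set
  Viable σ = ∀ (s : Scenario Prop) (c : Constraint Task Prop) → c ∈ constraints →
             s ⊨ Constraint.label c →
             (σ s (Constraint.Y c) - σ s (Constraint.X c)) ≤ Constraint.δ c

  InHist : Strategy → ℚ → Scenario Prop → Prop → Set
  InHist σ t s p = InScenario s (O p) × (σ s (O p) < t)

  HistEq : Strategy → ℚ → Scenario Prop → Scenario Prop → Set
  HistEq σ t s s' = ∀ p → ((InHist σ t s p → InHist σ t s' p) ×
                           (InHist σ t s' p → InHist σ t s p)) ×
                          (InHist σ t s p → s p ≡ s' p)

  Dynamic : Strategy → Set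
  Dynamic σ = ∀ (s s' : Scenario Prop) (X : Task) → InScenario s X →
              HistEq σ (σ s X) s s' →
              InScenario s' X × (σ s' X ≡ σ s X)

-- Q3SAT formulas  Φ = ∃x₁∀y₁ ⋯ ∃xₙ∀yₙ φ,  φ a 3-CNF with m clauses.
-- Index i : Fin n stands for the paper's i+1.

data QVar (n : ℕ) : Set where
  xv : Fin n → QVar n
  yv : Fin n → QVar n

record QLit (n : ℕ) : Set where
  constructor qlit
  field
    var      : QVar n
    positive : Bool

record Clause (n : ℕ) : Set where
  constructor clause
  field
    l₁ l₂ l₃ : QLit n

-- The matrix φ (the quantifier prefix is determined by n).
Formula : ℕ → ℕ → Set
Formula n m = Fin m → Clause n

-- A : Fin (suc n) → task, A i ↔ A_{i+1}; so A (inject₁ i) = A_i,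
-- A (suc i) = A_{i+1} and A (fromℕ n) = A_{n+1}; likewise B.
data ΓTask (n : ℕ) : Set where
  A B     : Fin (suc n) → ΓTask n
  C       : Fin n → Bool → ΓTask n   -- C i false = C_i^0, C i true = C_i^1
  D X Y   : Fin n → ΓTask n

data ΓProp (n : ℕ) : Set where
  x y : Fin n → ΓProp n
  c   : Fin n → Bool → ΓProp n       -- c i false = c_i^0, c i true = c_i^1

ΓO : {n : ℕ} → ΓProp n → ΓTask n
ΓO (x i)   = X i
ΓO (y i)   = Y i
ΓO (c i h) = C i h

ΓO-injective : {n : ℕ} → ∀ p q → ΓO {n} p ≡ ΓO q → p ≡ q
ΓO-injective (x i) (x .i) refl = refl
ΓO-injective (y i) (y .i) refl = refl
ΓO-injective (c i h) (c .i .h) refl = refl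

qvarProp : {n : ℕ} → QVar n → ΓProp n
qvarProp (xv i) = x i
qvarProp (yv i) = y i

negLit : {n : ℕ} → QLit n → Literal (ΓProp n)
negLit (qlit v b) = qvarProp v , not b

perIndex : (n : ℕ) → Fin n → List (Constraint (ΓTask n) (ΓProp n))
perIndex n i =
    cstr (D i) (B (inject₁ i)) (ℕ→ℚ 1) ((c i false , true) ∷ (c i true , true) ∷ [])
  ∷ cstr (A (inject₁ i)) (D i) (- ℕ→ℚ (n Data.Nat.+ 2)) ((c i false , false) ∷ (c i true , false) ∷ [])
  ∷ cstr (A (inject₁ i)) (X i) (- ℕ→ℚ (n Data.Nat.+ 2)) []
  ∷ cstr (X i) (Y i) (- ℕ→ℚ 1) []
  ∷ cstr (Y i) (A (Data.Fin.suc i)) (- ℕ→ℚ 1) []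
  ∷ cstr (B (Data.Fin.suc i)) (C i false) (ℕ→ℚ (n Data.Nat.+ 4)) ((x i , false) ∷ [])
  ∷ cstr (B (Data.Fin.suc i)) (C i true) (ℕ→ℚ (n Data.Nat.+ 4)) ((x i , true) ∷ [])
  ∷ []

perClause : (n : ℕ) → Clause n → Constraint (ΓTask n) (ΓProp n)
perClause n (clause l₁ l₂ l₃) =
  cstr (A (fromℕ n)) (B (fromℕ n)) (- ℕ→ℚ (suc n))
       (negLit l₁ ∷ negLit l₂ ∷ negLit l₃ ∷ [])

ΓConstraints : {n m : ℕ} → Formula n m → List (Constraint (ΓTask n) (ΓProp n))
ΓConstraints {n} {m} φ =
     cstr (B Data.Fin.zero) (A Data.Fin.zero) (ℕ→ℚ 0) []
  ∷ (concatMap (perIndex n) (allFin n) ++ map (λ j → perClause n (φ j)) (allFin m))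

Γ_Φ : {n m : ℕ} → Formula n m → CSTN
Γ_Φ {n} φ = record
  { Task        = ΓTask n
  ; Prop        = ΓProp n
  ; constraints = ΓConstraints φ
  ; L           = λ _ → []
  ; O           = ΓO
  ; O-injective = ΓO-injective
  }

-- Let θ = B_i + 1 and suppose that in s both C_i^0 and C_i^1 are executed after θ.
-- Changing the values of c_i^0 and c_i^1 then only alters observations made after θ.
-- For a dynamic strategy, the first observation on which two scenarios disagree is made
-- at the same instant in both (their histories agree before it), so it must disagree in
-- value; hence the schedules of s and of the modified scenario coincide up to θ.
-- Setting c_i^0 = c_i^1 = true activates D_i ≤ B_i + 1, so D_i ≤ θ there and hence in s;
-- setting both to false activates D_i ≥ A_i + (n+2), which gives A_i ≤ B_i − (n+1) there
-- and hence in s, contradicting B_i − A_i ≤ n.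
module Submission where

open import Defs
open import Data.Nat as ℕ using (ℕ)
open import Data.Nat.Coprimality using (1-coprimeTo)
import Data.Nat.Coprimality as Coprimality
open import Data.Integer as ℤ using (+_)
import Data.Integer.Properties as ℤ
open import Data.Rational
  using (ℚ; mkℚ; 0ℚ; 1ℚ; _/_; _≤_; _<_; _+_; _-_; -_; _⊓_)
open import Data.Rational.Properties
open import Data.Rational.Solver using (module +-*-Solver)
open import Data.Fin as Fin using (Fin; inject₁)
open import Data.Bool as Bool using (Bool; true; false)
open import Data.Product using (Σ; ∃-syntax; _×_; _,_; proj₂)
open import Data.Sum using (_⊎_; inj₁; inj₂)
open import Data.List using (List; []; _∷_; concatMap; allFin)
open import Data.List.Relation.Unary.All as All using (All; []; _∷_)
open import Data.List.Relation.Unary.Any using (here; there)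
open import Data.List.Membership.Propositional using (_∈_; lose)
open import Data.List.Membership.Propositional.Properties using (∈-++⁺ˡ; ∈-concatMap⁺; ∈-allFin)
open import Data.Empty using (⊥-elim)
open import Function using (_∘_)
open import Relation.Nullary using (¬_; yes; no; contradiction)
open import Relation.Nullary.Decidable using (_×-dec_)
open import Relation.Unary using (Decidable; ∁)
open import Relation.Unary.Properties using (∁?)
open import Relation.Binary.PropositionalEquality

ℕ→ℚ-+ : ∀ a b → ℕ→ℚ a + ℕ→ℚ b ≡ ℕ→ℚ (a ℕ.+ b)
ℕ→ℚ-+ a b = trans (cong₂ _+_ (ℕ→ℚ≡mkℚ a) (ℕ→ℚ≡mkℚ b))
                  (cong (_/ 1) (cong₂ ℤ._+_ (ℤ.*-identityʳ (+ a)) (ℤ.*-identityʳ (+ b))))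
  where
  ℕ→ℚ≡mkℚ : ∀ k → ℕ→ℚ k ≡ mkℚ (+ k) 0 (Coprimality.sym (1-coprimeTo k))
  ℕ→ℚ≡mkℚ k = normalize-coprime (Coprimality.sym (1-coprimeTo k))

ℕ→ℚ-nonNeg : ∀ k → 0ℚ ≤ ℕ→ℚ k
ℕ→ℚ-nonNeg k = nonNegative⁻¹ (ℕ→ℚ k) {{normalize-nonNeg k 1}}

≤⇒≯ : ∀ {p q} → p ≤ q → ¬ q < p
≤⇒≯ p≤q q<p = <-irrefl refl (<-≤-trans q<p p≤q)

p≤p+q : ∀ p {q} → 0ℚ ≤ q → p ≤ p + q
p≤p+q p 0≤q = subst (_≤ p + _) (+-identityʳ p) (+-monoʳ-≤ p 0≤q)

p-q≤p : ∀ p {q} → 0ℚ ≤ q → p - q ≤ p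
p-q≤p p 0≤q = subst (p - _ ≤_) (+-identityʳ p) (+-monoʳ-≤ p (neg-antimono-≤ 0≤q))

p-q≤r⇒p≤q+r : ∀ p q r → p - q ≤ r → p ≤ q + r
p-q≤r⇒p≤q+r p q r p-q≤r = subst₂ _≤_ p-q+q≡p (+-comm r q) (+-monoˡ-≤ q p-q≤r)
  where
  open +-*-Solver
  p-q+q≡p : (p - q) + q ≡ p
  p-q+q≡p = solve 2 (λ p q → (p :- q) :+ q := p) refl p q

gap-exceeds : ∀ n a b → a ≤ (b + 1ℚ) - ℕ→ℚ (n ℕ.+ 2) → ℕ→ℚ n < b - a
gap-exceeds n a b a≤ = begin-strict
  N                              ≡⟨ +-identityʳ N ⟨
  N + 0ℚ                         <⟨ +-monoʳ-< N (positive⁻¹ 1ℚ) ⟩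
  N + 1ℚ                         ≡⟨ solve 2 (λ N b → N :+ con 1ℚ :=
                                             b :- ((b :+ con 1ℚ) :- (N :+ con (ℕ→ℚ 2)))) refl N b ⟩
  b - ((b + 1ℚ) - (N + ℕ→ℚ 2))   ≡⟨ cong (λ k → b - ((b + 1ℚ) - k)) (ℕ→ℚ-+ n 2) ⟩
  b - ((b + 1ℚ) - ℕ→ℚ (n ℕ.+ 2)) ≤⟨ +-monoʳ-≤ b (neg-antimono-≤ a≤) ⟩
  b - a                          ∎
  where
  open ≤-Reasoning
  open +-*-Solver
  N = ℕ→ℚ n

least? : {A : Set} {P : A → Set} → Decidable P → (f : A → ℚ) (xs : List A) →
         All (∁ P) xs ⊎ ∃[ a ] P a × All (λ b → P b → f a ≤ f b) xs
least? P? f [] = inj₁ []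
least? P? f (a ∷ xs) with P? a | least? P? f xs
... | no ¬pa | inj₁ none = inj₁ (¬pa ∷ none)
... | no ¬pa | inj₂ (b , pb , b≤) = inj₂ (b , pb , (λ pa → contradiction pa ¬pa) ∷ b≤)
... | yes pa | inj₁ none = inj₂ (a , pa , (λ _ → ≤-refl) ∷ All.map (λ ¬pb pb → contradiction pb ¬pb) none)
... | yes pa | inj₂ (b , pb , b≤) with f a ≤? f b
...   | yes a≤b = inj₂ (a , pa , (λ _ → ≤-refl) ∷ All.map (λ b≤c pc → ≤-trans a≤b (b≤c pc)) b≤)
...   | no a≰b = inj₂ (b , pb , (λ _ → <⇒≤ (≰⇒> a≰b)) ∷ b≤)

module Synchronisation
  (Γ : CSTN) (σ : Strategy Γ) (dynamic : Dynamic Γ σ)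
  (unconditional : ∀ s X → InScenario Γ s X)
  (props : List (CSTN.Prop Γ)) (props-complete : ∀ p → p ∈ props)
  where

  open CSTN Γ

  private
    variable
      t θ : ℚ
      u v : Scenario Prop

  Agree : Scenario Prop → Scenario Prop → Prop → Set
  Agree u v p = σ u (O p) ≡ σ v (O p) × u p ≡ v p

  agree? : ∀ u v → Decidable (Agree u v)
  agree? u v p = (σ u (O p) ≟ σ v (O p)) ×-dec (u p Bool.≟ v p)

  agree-sym : ∀ {p} → Agree u v p → Agree v u p
  agree-sym (same-time , same-value) = sym same-time , sym same-value

  earliest : Scenario Prop → Scenario Prop → Prop → ℚ
  earliest u v p = σ u (O p) ⊓ σ v (O p)

  AgreeUntil : ℚ → Scenario Prop → Scenario Prop → Set
  AgreeUntil t u v = ∀ p → ¬ Agree u v p → t ≤ earliest u v p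

  agreeUntil-sym : AgreeUntil t u v → AgreeUntil t v u
  agreeUntil-sym {u = u} {v = v} until p ¬agree =
    subst (_ ≤_) (⊓-comm (σ u (O p)) (σ v (O p))) (until p (¬agree ∘ agree-sym))

  agreeUntil⇒histEq : AgreeUntil t u v → HistEq Γ σ t u v
  agreeUntil⇒histEq {t} {u} {v} until p with agree? u v p
  ... | yes (same-time , same-value) =
    (transfer same-time , transfer (sym same-time)) , λ _ → same-value
    where
    transfer : ∀ {w w'} → σ w (O p) ≡ σ w' (O p) → InHist Γ σ t w p → InHist Γ σ t w' p
    transfer same-time (_ , early) = unconditional _ _ , subst (_< t) same-time early
  ... | no ¬agree =
    (⊥-elim ∘ not-yet u-late , ⊥-elim ∘ not-yet v-late) , ⊥-elim ∘ not-yet u-late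
    where
    not-yet : ∀ {w} → t ≤ σ w (O p) → ¬ InHist Γ σ t w p
    not-yet late (_ , early) = ≤⇒≯ late early
    u-late : t ≤ σ u (O p)
    u-late = ≤-trans (until p ¬agree) (p⊓q≤p (σ u (O p)) (σ v (O p)))
    v-late : t ≤ σ v (O p)
    v-late = ≤-trans (until p ¬agree) (p⊓q≤q (σ u (O p)) (σ v (O p)))

  agreeUntil⇒same-time : ∀ {Z} → AgreeUntil (σ u Z) u v → σ v Z ≡ σ u Z
  agreeUntil⇒same-time {u} {v} {Z} until =
    proj₂ (dynamic u v Z (unconditional u Z) (agreeUntil⇒histEq until))

  first-disagreement-simultaneous : ∀ q → AgreeUntil (earliest u v q) u v →
                                    σ u (O q) ≡ σ v (O q)
  first-disagreement-simultaneous {u} {v} q until with ⊓-sel (σ u (O q)) (σ v (O q))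
  ... | inj₁ earliest≡u =
    sym (agreeUntil⇒same-time (subst (λ t → AgreeUntil t u v) earliest≡u until))
  ... | inj₂ earliest≡v =
    agreeUntil⇒same-time (agreeUntil-sym (subst (λ t → AgreeUntil t u v) earliest≡v until))

  disagreements-late : (∀ p → u p ≢ v p → θ < σ u (O p)) →
                       ∀ p → ¬ Agree u v p → θ < earliest u v p
  disagreements-late {u} {v} {θ} late p ¬agree
    with least? (∁? (agree? u v)) (earliest u v) props
  ... | inj₁ none = contradiction ¬agree (All.lookup none (props-complete p))
  ... | inj₂ (q , ¬agree-q , q-least) =
    <-≤-trans θ<first (first-until p ¬agree)
    where
    first-until : AgreeUntil (earliest u v q) u v
    first-until p' = All.lookup q-least (props-complete p')
    simultaneous : σ u (O q) ≡ σ v (O q)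
    simultaneous = first-disagreement-simultaneous q first-until
    θ<first : θ < earliest u v q
    θ<first = subst (θ <_) (trans (sym (⊓-idem _)) (cong (σ u (O q) ⊓_) simultaneous))
                    (late q (λ same-value → ¬agree-q (simultaneous , same-value)))

  agreeUntil-before : (∀ p → u p ≢ v p → θ < σ u (O p)) → t ≤ θ → AgreeUntil t u v
  agreeUntil-before late t≤θ p ¬agree = <⇒≤ (≤-<-trans t≤θ (disagreements-late late p ¬agree))

  synchronised : (∀ p → u p ≢ v p → θ < σ u (O p)) →
                 ∀ Z → σ u Z ≤ θ ⊎ σ v Z ≤ θ → σ u Z ≡ σ v Z
  synchronised late Z (inj₁ u-early) =
    sym (agreeUntil⇒same-time (agreeUntil-before late u-early))
  synchronised late Z (inj₂ v-early) =
    agreeUntil⇒same-time (agreeUntil-sym (agreeUntil-before late v-early))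

propsAt : ∀ {n} → Fin n → List (ΓProp n)
propsAt i = x i ∷ y i ∷ c i false ∷ c i true ∷ []

allProps : (n : ℕ) → List (ΓProp n)
allProps n = concatMap propsAt (allFin n)

∈-allProps : ∀ {n} (p : ΓProp n) → p ∈ allProps n
∈-allProps (x i)       = ∈-concatMap⁺ propsAt (lose (∈-allFin i) (here refl))
∈-allProps (y i)       = ∈-concatMap⁺ propsAt (lose (∈-allFin i) (there (here refl)))
∈-allProps (c i false) = ∈-concatMap⁺ propsAt (lose (∈-allFin i) (there (there (here refl))))
∈-allProps (c i true)  = ∈-concatMap⁺ propsAt (lose (∈-allFin i) (there (there (there (here refl)))))

withC : ∀ {n} → Scenario (ΓProp n) → Fin n → Bool → Scenario (ΓProp n)
withC s i b (c j h) with j Fin.≟ i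
... | yes _ = b
... | no _  = s (c j h)
withC s i b p = s p

withC-c : ∀ {n} (s : Scenario (ΓProp n)) i b h → withC s i b (c i h) ≡ b
withC-c s i b h with i Fin.≟ i
... | yes _  = refl
... | no i≢i = contradiction refl i≢i

withC-differs : ∀ {n} {s : Scenario (ΓProp n)} {i b} p → s p ≢ withC s i b p → ∃[ h ] p ≡ c i h
withC-differs (x j) s≢ = contradiction refl s≢
withC-differs (y j) s≢ = contradiction refl s≢
withC-differs {i = i} (c j h) s≢ with j Fin.≟ i
... | yes refl = h , refl
... | no _     = contradiction refl s≢

module ViableSchedules {n m : ℕ} (φ : Formula n m) (σ : Strategy (Γ_Φ φ))
                       (viable : Viable (Γ_Φ φ) σ) (s : Scenario (ΓProp n)) (i : Fin n) where

  private
    perIndex⊆ΓConstraints : ∀ {k} → k ∈ perIndex n i → k ∈ ΓConstraints φ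
    perIndex⊆ΓConstraints k∈ = there (∈-++⁺ˡ (∈-concatMap⁺ (perIndex n) (lose (∈-allFin i) k∈)))

  D-soon-after-B : s (c i false) ≡ true → s (c i true) ≡ true →
                   σ s (D i) ≤ σ s (B (inject₁ i)) + 1ℚ
  D-soon-after-B c⁰ c¹ =
    p-q≤r⇒p≤q+r _ _ _ (viable s _ (perIndex⊆ΓConstraints (here refl)) (c⁰ ∷ c¹ ∷ []))

  A-long-before-D : s (c i false) ≡ false → s (c i true) ≡ false →
                    σ s (A (inject₁ i)) ≤ σ s (D i) - ℕ→ℚ (n ℕ.+ 2)
  A-long-before-D c⁰ c¹ =
    p-q≤r⇒p≤q+r _ _ _ (viable s _ (perIndex⊆ΓConstraints (there (here refl))) (c⁰ ∷ c¹ ∷ []))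

C-late⇒gap : ∀ {n m} {φ : Formula n m} {σ : Strategy (Γ_Φ φ)} →
             Viable (Γ_Φ φ) σ → Dynamic (Γ_Φ φ) σ → ∀ s i →
             (∀ h → σ s (B (inject₁ i)) + 1ℚ < σ s (C i h)) →
             ℕ→ℚ n < σ s (B (inject₁ i)) - σ s (A (inject₁ i))
C-late⇒gap {n} {φ = φ} {σ} viable dynamic s i C-late = gap-exceeds n (σ s Aᵢ) (σ s Bᵢ) a≤
  where
  open Synchronisation (Γ_Φ φ) σ dynamic (λ _ _ → []) (allProps n) ∈-allProps
  open ViableSchedules φ σ viable
  Bᵢ = B (inject₁ i)
  Aᵢ = A (inject₁ i)
  θ  = σ s Bᵢ + 1ℚ
  N₂ = ℕ→ℚ (n ℕ.+ 2)
  s¹ = withC s i true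
  s⁰ = withC s i false

  same-until-θ : ∀ b Z → σ s Z ≤ θ ⊎ σ (withC s i b) Z ≤ θ → σ s Z ≡ σ (withC s i b) Z
  same-until-θ b = synchronised late
    where
    late : ∀ p → s p ≢ withC s i b p → θ < σ s (ΓO p)
    late p s≢ with withC-differs p s≢
    ... | h , refl = C-late h

  B¹≡B : σ s¹ Bᵢ ≡ σ s Bᵢ
  B¹≡B = sym (same-until-θ true Bᵢ (inj₁ (p≤p+q (σ s Bᵢ) (ℕ→ℚ-nonNeg 1))))

  D¹≤θ : σ s¹ (D i) ≤ θ
  D¹≤θ = subst (λ b → σ s¹ (D i) ≤ b + 1ℚ) B¹≡B
               (D-soon-after-B s¹ i (withC-c s i true false) (withC-c s i true true))

  D≡D¹ : σ s (D i) ≡ σ s¹ (D i)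
  D≡D¹ = same-until-θ true (D i) (inj₂ D¹≤θ)

  D≡D⁰ : σ s (D i) ≡ σ s⁰ (D i)
  D≡D⁰ = same-until-θ false (D i) (inj₁ (subst (_≤ θ) (sym D≡D¹) D¹≤θ))

  A⁰≤ : σ s⁰ Aᵢ ≤ θ - N₂
  A⁰≤ = begin
    σ s⁰ Aᵢ         ≤⟨ A-long-before-D s⁰ i (withC-c s i false false) (withC-c s i false true) ⟩
    σ s⁰ (D i) - N₂ ≡⟨ cong (_- N₂) (trans (sym D≡D⁰) D≡D¹) ⟩
    σ s¹ (D i) - N₂ ≤⟨ +-monoˡ-≤ (- N₂) D¹≤θ ⟩
    θ - N₂          ∎
    where open ≤-Reasoning

  a≤ : σ s Aᵢ ≤ θ - N₂
  a≤ = subst (_≤ θ - N₂) (sym A≡A⁰) A⁰≤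
    where
    A≡A⁰ : σ s Aᵢ ≡ σ s⁰ Aᵢ
    A≡A⁰ = same-until-θ false Aᵢ (inj₂ (≤-trans A⁰≤ (p-q≤p θ (ℕ→ℚ-nonNeg (n ℕ.+ 2)))))

lemma18 : {n m : ℕ} (φ : Formula n m) (σ : Strategy (Γ_Φ φ)) →
          Viable (Γ_Φ φ) σ → Dynamic (Γ_Φ φ) σ →
          (s : Scenario (ΓProp n)) (i : Fin n) →
          (σ s (B (inject₁ i)) - σ s (A (inject₁ i))) ≤ ℕ→ℚ n →
          Σ Bool (λ h → σ s (C i h) ≤ (σ s (B (inject₁ i)) + ℕ→ℚ 1))
lemma18 φ σ viable dynamic s i gap≤n
  with σ s (C i false) ≤? σ s (B (inject₁ i)) + 1ℚ | σ s (C i true) ≤? σ s (B (inject₁ i)) + 1ℚ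
... | yes C⁰-early | _              = false , C⁰-early
... | no _         | yes C¹-early   = true , C¹-early
... | no C⁰-late   | no C¹-late     = contradiction (C-late⇒gap viable dynamic s i C-late) (≤⇒≯ gap≤n)
  where
  C-late : ∀ h → σ s (B (inject₁ i)) + 1ℚ < σ s (C i h)
  C-late false = ≰⇒> C⁰-late
  C-late true  = ≰⇒> C¹-late
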